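{- Let $G$ be a finite non-cyclic nilpotent group with $|G|=p^mq^n$, where $p,q$ are distinct primes and $m,n\ge 1$, and let $e$ be its identity. Let $u,v\in G\setminus\{e\}$ with $\langle u\rangle\cap\langle v\rangle=\{e\}$, satisfying one of the following: (i) both $u$ and $v$ have order a positive power of $p$; (ii) both $u$ and $v$ have order a positive power of $q$; (iii) both $o(u)$ and $o(v)$ are divisible by both $p$ and $q$. Then any shortest path between $u$ and $v$ in $Pow(G)$ among the paths not passing through $e$ has length $4$.
   Context: For a finite group $G$, the power graph $Pow(G)$ is the simple undirected graph with vertex set $G$ in which two distinct elements $x,y$ are adjacent if and only if one of them is an integer power of the other. A finite group is nilpotent if it is the direct product of its Sylow subgroups. $o(x)$ denotes the order of $x$. -}

module Defs where

open import Level using (0ℓ)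
open import Data.Nat using (ℕ; zero; suc; _+_; _*_; _^_; _≤_; _<_)
open import Data.Nat.Divisibility using (_∣_)
open import Data.Integer using (ℤ; +_; -[1+_])
open import Data.Fin using (Fin; toℕ) renaming (zero to fzero; suc to fsuc)
open import Data.Fin.Subset using (Subset; _∈_; ∣_∣)
open import Data.Product using (Σ; ∃; ∃-syntax; _×_; _,_)
open import Data.Sum using (_⊎_)
open import Relation.Nullary using (¬_)
open import Relation.Binary.PropositionalEquality using (_≡_; _≢_)
open import Algebra.Structures using (IsGroup)

-- A finite group of order N, presented on the carrier Fin N
-- (every finite group of order N is isomorphic to such a group).
record FinGroup (N : ℕ) : Set where
  field
    _∙_ : Fin N → Fin N → Fin N
    ε   : Fin N
    _⁻¹ : Fin N → Fin N
    isGroup : IsGroup (_≡_ {A = Fin N}) _∙_ ε _⁻¹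
  infixl 7 _∙_
  infix 8 _⁻¹

  powℕ : Fin N → ℕ → Fin N
  powℕ x zero    = ε
  powℕ x (suc k) = x ∙ powℕ x k

  pow : Fin N → ℤ → Fin N
  pow x (+ k)      = powℕ x k
  pow x -[1+ k ]   = (powℕ x (suc k)) ⁻¹

  InCyclic : Fin N → Fin N → Set
  InCyclic x y = ∃[ k ] y ≡ pow x k

  OrderIs : Fin N → ℕ → Set
  OrderIs x k = (0 < k) × (powℕ x k ≡ ε) × (∀ j → 0 < j → j < k → powℕ x j ≢ ε)

  Cyclic : Set
  Cyclic = ∃[ g ] ∀ x → InCyclic g x

  IsSubgroup : Subset N → Set
  IsSubgroup S = (ε ∈ S) × (∀ a b → a ∈ S → b ∈ S → (a ∙ b) ∈ S) × (∀ a → a ∈ S → (a ⁻¹) ∈ S)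

  -- G (of order p^m q^n) is nilpotent: G is the (internal) direct product of
  -- its Sylow p-subgroup P (order p^m) and Sylow q-subgroup Q (order q^n).
  NilpotentPQ : ℕ → ℕ → ℕ → ℕ → Set
  NilpotentPQ p m q n =
    ∃[ P ] ∃[ Q ] IsSubgroup P × IsSubgroup Q × ∣ P ∣ ≡ p ^ m × ∣ Q ∣ ≡ q ^ n
      × (∀ a b → a ∈ P → b ∈ Q → a ∙ b ≡ b ∙ a)
      × (∀ g → a∈P-b∈Q-decomp P Q g)
      × (∀ g → g ∈ P → g ∈ Q → g ≡ ε)
    where
    a∈P-b∈Q-decomp : Subset N → Subset N → Fin N → Set
    a∈P-b∈Q-decomp P Q g = ∃[ a ] ∃[ b ] a ∈ P × b ∈ Q × g ≡ a ∙ b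

  PowAdj : Fin N → Fin N → Set
  PowAdj x y = x ≢ y × (InCyclic x y ⊎ InCyclic y x)

  AvoidingPath : Fin N → Fin N → ℕ → Set
  AvoidingPath u v k =
    Σ (Fin (suc k) → Fin N) λ w →
      (w fzero ≡ u) × (w (Data.Fin.fromℕ k) ≡ v)
      × (∀ (i : Fin k) → PowAdj (w (Data.Fin.inject₁ i)) (w (fsuc i)))
      × (∀ i → w i ≢ ε)
      × (∀ i j → w i ≡ w j → i ≡ j)

{-# OPTIONS --safe #-}
-- A cyclic group has at most one subgroup of order r for each prime r. Hence if ⟨w⟩ contained both
-- a nontrivial power x of u and v, and r divided o(x) and o(v), the elements of order r in ⟨x⟩ and
-- ⟨v⟩ would have a common nontrivial power, contradicting ⟨u⟩ ∩ ⟨v⟩ = {e}. Each of (i)–(iii) supplies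
-- such an r for every nontrivial power of u (and symmetrically of v), and a case analysis on the
-- directions of the edges of u — w₁ — w₂ — v excludes every path of length at most 3 avoiding e.
-- Conversely G = P × Q with P, Q its Sylow subgroups, and for a ∈ P, b ∈ Q both a and b are powers
-- of ab as their orders are coprime. This gives the paths u — uy — y — vy — v with y ∈ Q nontrivial in
-- case (i), symmetrically in case (ii), and ab — a — ab′ — b′ — a′b′ for u = ab, v = a′b′ in case (iii).

module Submission where

open import Defs
open import Data.Nat using (ℕ; _^_; _*_; _≤_; _<_)
open import Data.Nat.Divisibility using (_∣_)
open import Data.Nat.Primality using (Prime)
open import Data.Fin using (Fin)
open import Data.Product using (∃-syntax; _×_)
open import Data.Sum using (_⊎_)
open import Relation.Nullary using (¬_)
open import Relation.Binary.PropositionalEquality using (_≡_; _≢_)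

open import Algebra.Bundles using (Group)
open import Algebra.Structures using (IsGroup)
import Algebra.Properties.Group as GroupProperties
import Algebra.Properties.Monoid.Mult as MonoidMultiplication
open import Data.Empty using (⊥)
open import Data.Fin using (toℕ; fromℕ<; inject₁) renaming (zero to fzero; suc to fsuc)
open import Data.Fin.Properties using (pigeonhole; any?; toℕ<n; toℕ-fromℕ<) renaming (_≟_ to _≟ᶠ_)
open import Data.Fin.Subset using (Subset; _∈_; _∉_; _─_; _-_; ⁅_⁆; inside; outside)
open import Data.Fin.Subset.Properties
  using (p─⊥≡p; p─q⊆p; x∈⁅x⁆; x∈p∧x≢y⇒x∈p-y; nonempty?; Empty-unique; ∣⊥∣≡0; ∣⊤∣≡n; ∈⊤)
open import Data.Integer using (+_; -[1+_])
open import Data.Nat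
  using (zero; suc; _+_; _∸_; _<?_; z<s; s≤s; NonZero; ≢-nonZero; ≢-nonZero⁻¹; >-nonZero; nonTrivial⇒≢1; nonTrivial⇒n>1)
open import Data.Nat.Coprimality as Coprime using (Coprime; coprime-divisor; 1-coprimeTo)
open import Data.Nat.DivMod using (_%_; _/_; m≡m%n+[m/n]*n; m%n<n)
open import Data.Nat.Divisibility
  using (_∤_; _∣?_; divides; ∣-refl; ∣-trans; ∣1⇒≡1; _∣0; ∣m∣n⇒∣m+n; m∣m*n; *-cancelˡ-∣; m%n≡0⇒n∣m)
open import Data.Nat.GCD using (gcd; module Bézout)
open import Data.Nat.Induction using (<-wellFounded)
open import Data.Nat.LCM using (lcm; lcm-least; gcd*lcm; m∣lcm[m,n]; n∣lcm[m,n])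
open import Data.Nat.Primality using (prime⇒irreducible; prime⇒nonTrivial)
open import Data.Nat.Properties
  using ( *-comm; *-assoc; *-identityʳ; *-cancelʳ-≡; m*n≢0; +-suc; ^-monoʳ-<; m<m*n; m<n+m; n<1+n
        ; m<n⇒0<n∸m; m+[n∸m]≡n; m∸n≤m; <⇒≤; <-irrefl; <-trans; ≤-<-trans; ≤-refl; ≤-pred
        ; m≤n⇒m<n∨m≡n; m≤n⇒m≤1+n)
open import Data.Product using (∃; _,_; proj₁; proj₂)
open import Data.Sum using (inj₁; inj₂; [_,_]′)
import Data.Sum as Sum
open import Data.Vec.Base using (Vec; []; _∷_; here; there; lookup)
open import Data.Vec.Relation.Unary.All using (All; []; _∷_)
open import Data.Vec.Relation.Unary.All.Properties using (lookup⁺)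
open import Data.Vec.Relation.Unary.Unique.Propositional using (Unique; []; _∷_)
open import Data.Vec.Relation.Unary.Unique.Propositional.Properties using (lookup-injective)
open import Function using (_∘_)
open import Induction.WellFounded using (Acc; acc)
open import Level using (0ℓ)
open import Relation.Binary.PropositionalEquality using (refl; sym; trans; cong; subst; subst₂; module ≡-Reasoning)
open import Relation.Nullary using (yes; no; contradiction)
open import Relation.Nullary.Decidable using (_×-dec_)
open ≡-Reasoning

-- Coprimality and least common multiples

coprime-*ʳ : ∀ {m n o} → Coprime m n → Coprime m o → Coprime m (n * o)
coprime-*ʳ m⊥n m⊥o (d∣m , d∣n*o) =
  m⊥o (d∣m , coprime-divisor (λ (e∣d , e∣n) → m⊥n (∣-trans e∣d d∣m , e∣n)) d∣n*o)

coprime-^ʳ : ∀ {m n} k → Coprime m n → Coprime m (n ^ k)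
coprime-^ʳ zero    _   = Coprime.sym (1-coprimeTo _)
coprime-^ʳ (suc k) m⊥n = coprime-*ʳ m⊥n (coprime-^ʳ k m⊥n)

coprime-^ : ∀ {m n} j k → Coprime m n → Coprime (m ^ j) (n ^ k)
coprime-^ j k m⊥n = Coprime.sym (coprime-^ʳ j (Coprime.sym (coprime-^ʳ k m⊥n)))

prime⇒≢1 : ∀ {p} → Prime p → p ≢ 1
prime⇒≢1 p-prime = nonTrivial⇒≢1 {{prime⇒nonTrivial p-prime}}

prime>1 : ∀ {p} → Prime p → 1 < p
prime>1 {p} p-prime = nonTrivial⇒n>1 p {{prime⇒nonTrivial p-prime}}

1<prime^ : ∀ {p k} → Prime p → 1 ≤ k → 1 < p ^ k
1<prime^ {p} p-prime 1≤k = ^-monoʳ-< p (prime>1 p-prime) 1≤k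

prime∤⇒coprime : ∀ {p n} → Prime p → p ∤ n → Coprime p n
prime∤⇒coprime p-prime p∤n (d∣p , d∣n) with prime⇒irreducible p-prime d∣p
... | inj₁ d≡1 = d≡1
... | inj₂ refl = contradiction d∣n p∤n

distinct-primes-coprime : ∀ {p q} → Prime p → Prime q → p ≢ q → Coprime p q
distinct-primes-coprime p-prime q-prime p≢q = prime∤⇒coprime p-prime λ p∣q →
  [ prime⇒≢1 p-prime , p≢q ]′ (prime⇒irreducible q-prime p∣q)

prime∤prime^ : ∀ {p q} → Prime p → Prime q → p ≢ q → ∀ k → p ∤ q ^ k
prime∤prime^ p-prime q-prime p≢q k p∣qᵏ = prime⇒≢1 p-prime
  (coprime-^ʳ k (distinct-primes-coprime p-prime q-prime p≢q) (∣-refl , p∣qᵏ))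

lcm≢0 : ∀ m n .{{_ : NonZero m}} .{{_ : NonZero n}} → lcm m n ≢ 0
lcm≢0 m n lcm≡0 = ≢-nonZero⁻¹ (m * n) {{m*n≢0 m n}} (begin
  m * n               ≡⟨ sym (gcd*lcm m n) ⟩
  gcd m n * lcm m n   ≡⟨ cong (gcd m n *_) lcm≡0 ⟩
  gcd m n * 0         ≡⟨ *-comm (gcd m n) 0 ⟩
  0                   ∎)

-- If s * i = t * j = lcm i j and d divides s and t, then (s / d) * i is a smaller common multiple.
lcm-cofactors-coprime : ∀ {i j s t} → lcm i j ≢ 0 → lcm i j ≡ s * i → lcm i j ≡ t * j → Coprime s t
lcm-cofactors-coprime {i} {j} {s} {t} L≢0 L≡s*i L≡t*j {d} (divides s′ s≡s′*d , divides t′ t≡t′*d) =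
  ∣1⇒≡1 (*-cancelˡ-∣ M {{≢-nonZero M≢0}} (subst (_∣ M * 1) (sym M*d≡L) L∣M′))
  where
  M : ℕ
  M = s′ * i
  cofactor-swap : ∀ c k → c * d * k ≡ c * k * d
  cofactor-swap c k = trans (*-assoc c d k) (trans (cong (c *_) (*-comm d k)) (sym (*-assoc c k d)))
  M*d≡L : M * d ≡ lcm i j
  M*d≡L = begin
    s′ * i * d   ≡⟨ sym (cofactor-swap s′ i) ⟩
    s′ * d * i   ≡⟨ cong (_* i) (sym s≡s′*d) ⟩
    s * i        ≡⟨ sym L≡s*i ⟩
    lcm i j      ∎
  t′*j*d≡L : t′ * j * d ≡ lcm i j
  t′*j*d≡L = trans (sym (cofactor-swap t′ j)) (trans (cong (_* j) (sym t≡t′*d)) (sym L≡t*j))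
  M≢0 : M ≢ 0
  M≢0 M≡0 = L≢0 (trans (sym M*d≡L) (cong (_* d) M≡0))
  d≢0 : d ≢ 0
  d≢0 d≡0 = L≢0 (trans (sym M*d≡L) (trans (cong (M *_) d≡0) (*-comm M 0)))
  M≡t′*j : M ≡ t′ * j
  M≡t′*j = *-cancelʳ-≡ M (t′ * j) d {{≢-nonZero d≢0}} (trans M*d≡L (sym t′*j*d≡L))
  L∣M′ : lcm i j ∣ M * 1
  L∣M′ = lcm-least (divides s′ (*-identityʳ M)) (divides t′ (trans (*-identityʳ M) M≡t′*j))

-- ∣_∣ is opened locally: at top level it makes `p ∣ k × q ∣ k` ambiguous.
module _ where
  open import Data.Fin.Subset using (∣_∣)

  ∣p∣≡1+∣p-x∣ : ∀ {n} {x : Fin n} {p : Subset n} → x ∈ p → ∣ p ∣ ≡ suc ∣ p - x ∣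
  ∣p∣≡1+∣p-x∣ {x = fzero}  {inside ∷ p}  here        = cong suc (cong ∣_∣ (sym (p─⊥≡p p)))
  ∣p∣≡1+∣p-x∣ {x = fsuc x} {inside ∷ p}  (there x∈p) = cong suc (∣p∣≡1+∣p-x∣ x∈p)
  ∣p∣≡1+∣p-x∣ {x = fsuc x} {outside ∷ p} (there x∈p) = ∣p∣≡1+∣p-x∣ x∈p

  x∈p─q⇒x∉q : ∀ {n} {x : Fin n} {p q : Subset n} → x ∈ p ─ q → x ∉ q
  x∈p─q⇒x∉q {x = fzero}  {inside ∷ p} {outside ∷ q} here ()
  x∈p─q⇒x∉q {x = fsuc x} {_ ∷ p}      {_ ∷ q}       (there x∈p─q) (there x∈q) = x∈p─q⇒x∉q x∈p─q x∈q

  x∈p-y⇒x≢y : ∀ {n} {x y : Fin n} {p : Subset n} → x ∈ p - y → x ≢ y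
  x∈p-y⇒x≢y x∈p-y refl = x∈p─q⇒x∉q x∈p-y (x∈⁅x⁆ _)

  ∣p∣>1⇒∃y≢x : ∀ {n} {x : Fin n} {p : Subset n} → x ∈ p → 1 < ∣ p ∣ → ∃[ y ] y ∈ p × y ≢ x
  ∣p∣>1⇒∃y≢x {n} {x} {p} x∈p 1<∣p∣ with nonempty? (p - x)
  ... | yes (y , y∈p-x) = y , p─q⊆p p ⁅ x ⁆ y∈p-x , x∈p-y⇒x≢y y∈p-x
  ... | no  ∄y          = contradiction (subst (1 <_) ∣p∣≡1 1<∣p∣) (<-irrefl refl)
    where
    ∣p∣≡1 : ∣ p ∣ ≡ 1
    ∣p∣≡1 = trans (∣p∣≡1+∣p-x∣ x∈p) (cong suc (trans (cong ∣_∣ (Empty-unique ∄y)) (∣⊥∣≡0 n)))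

module FinGroupTheory {N : ℕ} (G : FinGroup N) where
  open FinGroup G
  open import Data.Fin.Subset using (∣_∣)
  private
    E : Set
    E = Fin N

  group : Group 0ℓ 0ℓ
  group = record { Carrier = E ; _≈_ = _≡_ ; _∙_ = _∙_ ; ε = ε ; _⁻¹ = _⁻¹ ; isGroup = isGroup }

  open IsGroup isGroup using (assoc; identityˡ; identityʳ)
  open GroupProperties group
    using (identityʳ-unique; inverseʳ-unique; ⁻¹-involutive; ∙-cancelˡ; ∙-cancelʳ; x≈z//y; \\-leftDividesˡ; \\-leftDividesʳ)
  open MonoidMultiplication (Group.monoid group) using (×-homo-+; ×-assocˡ) renaming (_×_ to _·_)

  -- Powers and orders

  powℕ≡× : ∀ x k → powℕ x k ≡ k · x
  powℕ≡× x zero    = refl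
  powℕ≡× x (suc k) = cong (x ∙_) (powℕ≡× x k)

  powℕ-+ : ∀ x m n → powℕ x (m + n) ≡ powℕ x m ∙ powℕ x n
  powℕ-+ x m n rewrite powℕ≡× x (m + n) | powℕ≡× x m | powℕ≡× x n = ×-homo-+ x m n

  powℕ-* : ∀ x m n → powℕ x (m * n) ≡ powℕ (powℕ x n) m
  powℕ-* x m n rewrite powℕ≡× x (m * n) | powℕ≡× (powℕ x n) m | powℕ≡× x n = sym (×-assocˡ x m n)

  powℕ-ε : ∀ k → powℕ ε k ≡ ε
  powℕ-ε zero    = refl
  powℕ-ε (suc k) = trans (identityˡ _) (powℕ-ε k)

  powℕ-∣ : ∀ {x o t} → o ∣ t → powℕ x o ≡ ε → powℕ x t ≡ ε
  powℕ-∣ {x} {o} (divides c refl) xᵒ≡ε = begin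
    powℕ x (c * o)        ≡⟨ powℕ-* x c o ⟩
    powℕ (powℕ x o) c     ≡⟨ cong (λ g → powℕ g c) xᵒ≡ε ⟩
    powℕ ε c              ≡⟨ powℕ-ε c ⟩
    ε                     ∎

  powℕ-∸ : ∀ {x i j} → i ≤ j → powℕ x i ≡ powℕ x j → powℕ x (j ∸ i) ≡ ε
  powℕ-∸ {x} {i} {j} i≤j xⁱ≡xʲ = identityʳ-unique (powℕ x i) _ (begin
    powℕ x i ∙ powℕ x (j ∸ i)   ≡⟨ sym (powℕ-+ x i (j ∸ i)) ⟩
    powℕ x (i + (j ∸ i))        ≡⟨ cong (powℕ x) (m+[n∸m]≡n i≤j) ⟩
    powℕ x j                    ≡⟨ sym xⁱ≡xʲ ⟩
    powℕ x i                    ∎)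

  powℕ-comm : ∀ {x y} → x ∙ y ≡ y ∙ x → ∀ k → powℕ x k ∙ y ≡ y ∙ powℕ x k
  powℕ-comm {x} {y} xy≡yx zero    = trans (identityˡ y) (sym (identityʳ y))
  powℕ-comm {x} {y} xy≡yx (suc k) = begin
    (x ∙ powℕ x k) ∙ y   ≡⟨ assoc _ _ _ ⟩
    x ∙ (powℕ x k ∙ y)   ≡⟨ cong (x ∙_) (powℕ-comm xy≡yx k) ⟩
    x ∙ (y ∙ powℕ x k)   ≡⟨ sym (assoc _ _ _) ⟩
    (x ∙ y) ∙ powℕ x k   ≡⟨ cong (_∙ powℕ x k) xy≡yx ⟩
    (y ∙ x) ∙ powℕ x k   ≡⟨ assoc _ _ _ ⟩
    y ∙ (x ∙ powℕ x k)   ∎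

  powℕ-∙ : ∀ {x y} → x ∙ y ≡ y ∙ x → ∀ k → powℕ (x ∙ y) k ≡ powℕ x k ∙ powℕ y k
  powℕ-∙ xy≡yx zero = sym (identityˡ ε)
  powℕ-∙ {x} {y} xy≡yx (suc k) = begin
    (x ∙ y) ∙ powℕ (x ∙ y) k            ≡⟨ cong ((x ∙ y) ∙_) (powℕ-∙ xy≡yx k) ⟩
    (x ∙ y) ∙ (powℕ x k ∙ powℕ y k)     ≡⟨ assoc _ _ _ ⟩
    x ∙ (y ∙ (powℕ x k ∙ powℕ y k))     ≡⟨ cong (x ∙_) (sym (assoc _ _ _)) ⟩
    x ∙ ((y ∙ powℕ x k) ∙ powℕ y k)     ≡⟨ cong (λ g → x ∙ (g ∙ powℕ y k)) (sym (powℕ-comm xy≡yx k)) ⟩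
    x ∙ ((powℕ x k ∙ y) ∙ powℕ y k)     ≡⟨ cong (x ∙_) (assoc _ _ _) ⟩
    x ∙ (powℕ x k ∙ (y ∙ powℕ y k))     ≡⟨ sym (assoc _ _ _) ⟩
    (x ∙ powℕ x k) ∙ (y ∙ powℕ y k)     ∎

  powℕ-∙-ε : ∀ {a b t} → a ∙ b ≡ b ∙ a → powℕ b t ≡ ε → powℕ (a ∙ b) t ≡ powℕ a t
  powℕ-∙-ε {a} {b} {t} ab≡ba bᵗ≡ε = begin
    powℕ (a ∙ b) t         ≡⟨ powℕ-∙ ab≡ba t ⟩
    powℕ a t ∙ powℕ b t    ≡⟨ cong (powℕ a t ∙_) bᵗ≡ε ⟩
    powℕ a t ∙ ε           ≡⟨ identityʳ _ ⟩
    powℕ a t               ∎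

  Bézout⇒ε : ∀ {x m n a b} → 1 + b * n ≡ a * m → powℕ x m ≡ ε → powℕ x n ≡ ε → x ≡ ε
  Bézout⇒ε {x} {m} {n} {a} {b} 1+b*n≡a*m xᵐ≡ε xⁿ≡ε = begin
    x                    ≡⟨ sym (identityʳ x) ⟩
    x ∙ ε                ≡⟨ cong (x ∙_) (sym (powℕ-∣ (divides b refl) xⁿ≡ε)) ⟩
    powℕ x (1 + b * n)   ≡⟨ cong (powℕ x) 1+b*n≡a*m ⟩
    powℕ x (a * m)       ≡⟨ powℕ-∣ (divides a refl) xᵐ≡ε ⟩
    ε                    ∎

  coprime-exponents⇒ε : ∀ {x c d} → Coprime c d → powℕ x c ≡ ε → powℕ x d ≡ ε → x ≡ ε
  coprime-exponents⇒ε {c = c} {d} c⊥d xᶜ≡ε xᵈ≡ε with Coprime.coprime-Bézout c⊥d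
  ... | Bézout.+- a b 1+b*d≡a*c = Bézout⇒ε {m = c} {d} {a} {b} 1+b*d≡a*c xᶜ≡ε xᵈ≡ε
  ... | Bézout.-+ a b 1+a*c≡b*d = Bézout⇒ε {m = d} {c} {b} {a} 1+a*c≡b*d xᵈ≡ε xᶜ≡ε

  ∃powℕ≡ε : ∀ x → ∃[ k ] 0 < k × powℕ x k ≡ ε
  ∃powℕ≡ε x with pigeonhole (n<1+n N) (λ (i : Fin (suc N)) → powℕ x (toℕ i))
  ... | i , j , i<j , xⁱ≡xʲ = toℕ j ∸ toℕ i , m<n⇒0<n∸m i<j , powℕ-∸ (<⇒≤ i<j) xⁱ≡xʲ

  least-exponent : ∀ {x} k → Acc _<_ k → 0 < k → powℕ x k ≡ ε → ∃ (OrderIs x)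
  least-exponent {x} k (acc smaller) 0<k xᵏ≡ε
    with any? (λ (j : Fin k) → (0 <? toℕ j) ×-dec (powℕ x (toℕ j) ≟ᶠ ε))
  ... | yes (j , 0<j , xʲ≡ε) = least-exponent (toℕ j) (smaller (toℕ<n j)) 0<j xʲ≡ε
  ... | no ∄j = k , 0<k , xᵏ≡ε , λ j 0<j j<k xʲ≡ε →
    ∄j (fromℕ< j<k , subst (λ i → 0 < i × powℕ x i ≡ ε) (sym (toℕ-fromℕ< j<k)) (0<j , xʲ≡ε))

  order : ∀ x → ∃ (OrderIs x)
  order x with ∃powℕ≡ε x
  ... | k , 0<k , xᵏ≡ε = least-exponent k (<-wellFounded k) 0<k xᵏ≡ε

  order∣ : ∀ {x o t} → OrderIs x o → powℕ x t ≡ ε → o ∣ t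
  order∣ {x} {o} {t} (0<o , xᵒ≡ε , below-o) xᵗ≡ε =
    m%n≡0⇒n∣m t o (remainder≡0 (t % o) (m%n<n t o) xʳ≡ε)
    where
    instance
      o≢0 : NonZero o
      o≢0 = >-nonZero 0<o
    xʳ≡ε : powℕ x (t % o) ≡ ε
    xʳ≡ε = begin
      powℕ x (t % o)                         ≡⟨ sym (identityʳ _) ⟩
      powℕ x (t % o) ∙ ε                     ≡⟨ cong (powℕ x (t % o) ∙_) (sym (powℕ-∣ (divides (t / o) refl) xᵒ≡ε)) ⟩
      powℕ x (t % o) ∙ powℕ x (t / o * o)    ≡⟨ sym (powℕ-+ x (t % o) _) ⟩
      powℕ x (t % o + t / o * o)             ≡⟨ cong (powℕ x) (sym (m≡m%n+[m/n]*n t o)) ⟩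
      powℕ x t                               ≡⟨ xᵗ≡ε ⟩
      ε                                      ∎
    remainder≡0 : ∀ r → r < o → powℕ x r ≡ ε → r ≡ 0
    remainder≡0 zero    _   _    = refl
    remainder≡0 (suc r) r<o xʳ≡ε = contradiction xʳ≡ε (below-o (suc r) z<s r<o)

  powℕ≢ε-by-order : ∀ {x o r e} → OrderIs x o → r ∣ o → r ∤ e → powℕ x e ≢ ε
  powℕ≢ε-by-order x-order r∣o r∤e xᵉ≡ε = r∤e (∣-trans r∣o (order∣ x-order xᵉ≡ε))

  -- Lagrange's theorem

  powℕ-closed : ∀ {S a} → IsSubgroup S → a ∈ S → ∀ k → powℕ a k ∈ S
  powℕ-closed (ε∈S , _ , _) a∈S zero = ε∈S
  powℕ-closed S-subgroup@(_ , ∙-closed , _) a∈S (suc k) = ∙-closed _ _ a∈S (powℕ-closed S-subgroup a∈S k)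

  LeftClosed : E → Subset N → Set
  LeftClosed x T = ∀ s → s ∈ T → x ∙ s ∈ T

  powℕ-∙-closed : ∀ {x T s} → LeftClosed x T → s ∈ T → ∀ i → powℕ x i ∙ s ∈ T
  powℕ-∙-closed {s = s} closed s∈T zero = subst (_∈ _) (sym (identityˡ s)) s∈T
  powℕ-∙-closed {T = T} closed s∈T (suc i) =
    subst (_∈ T) (sym (assoc _ _ _)) (closed _ (powℕ-∙-closed closed s∈T i))

  -- A set closed under left multiplication by x is a disjoint union of orbits {x ^ i ∙ t | i < o(x)}.
  module Orbits {x k} (x-order : OrderIs x (suc k)) where

    delete : Subset N → E → ℕ → Subset N
    delete T t zero    = T
    delete T t (suc i) = delete T t i - powℕ x i ∙ t

    ∈-delete⁻ : ∀ {T t g} i → g ∈ delete T t i → g ∈ T × (∀ j → j < i → g ≢ powℕ x j ∙ t)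
    ∈-delete⁻ zero g∈T = g∈T , λ _ ()
    ∈-delete⁻ (suc i) g∈ with ∈-delete⁻ i (p─q⊆p _ _ g∈)
    ... | g∈T , g∉orbit = g∈T , λ j j<1+i →
      [ g∉orbit j , (λ { refl → x∈p-y⇒x≢y g∈ }) ]′ (m≤n⇒m<n∨m≡n (≤-pred j<1+i))

    ∈-delete⁺ : ∀ {T t g} i → g ∈ T → (∀ j → j < i → g ≢ powℕ x j ∙ t) → g ∈ delete T t i
    ∈-delete⁺ zero    g∈T _       = g∈T
    ∈-delete⁺ (suc i) g∈T g∉orbit =
      x∈p∧x≢y⇒x∈p-y (∈-delete⁺ i g∈T (λ j j<i → g∉orbit j (m≤n⇒m≤1+n j<i))) (g∉orbit i ≤-refl)

    orbit-injective : ∀ {i j t} → i < j → j < suc k → powℕ x i ∙ t ≢ powℕ x j ∙ t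
    orbit-injective {i} {j} {t} i<j j<o xⁱt≡xʲt = proj₂ (proj₂ x-order) (j ∸ i) (m<n⇒0<n∸m i<j)
      (≤-<-trans (m∸n≤m j i) j<o) (powℕ-∸ (<⇒≤ i<j) (∙-cancelʳ t _ _ xⁱt≡xʲt))

    ∣delete∣ : ∀ {T t} → LeftClosed x T → t ∈ T → ∀ i → i ≤ suc k → ∣ T ∣ ≡ i + ∣ delete T t i ∣
    ∣delete∣ closed t∈T zero    _     = refl
    ∣delete∣ {T} {t} closed t∈T (suc i) i<o = begin
      ∣ T ∣                               ≡⟨ ∣delete∣ closed t∈T i (<⇒≤ i<o) ⟩
      i + ∣ delete T t i ∣                ≡⟨ cong (λ n → i + n) (∣p∣≡1+∣p-x∣ xⁱt∈) ⟩
      i + suc ∣ delete T t (suc i) ∣      ≡⟨ +-suc i _ ⟩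
      suc i + ∣ delete T t (suc i) ∣      ∎
      where
      xⁱt∈ : powℕ x i ∙ t ∈ delete T t i
      xⁱt∈ = ∈-delete⁺ i (powℕ-∙-closed closed t∈T i) (λ j j<i xⁱt≡xʲt → orbit-injective j<i i<o (sym xⁱt≡xʲt))

    delete-closed : ∀ {T t} → LeftClosed x T → LeftClosed x (delete T t (suc k))
    delete-closed {T} {t} closed s s∈ with ∈-delete⁻ (suc k) s∈
    ... | s∈T , s∉orbit = ∈-delete⁺ (suc k) (closed s s∈T) xs∉orbit
      where
      xs∉orbit : ∀ j → j < suc k → x ∙ s ≢ powℕ x j ∙ t
      xs∉orbit zero _ xs≡t = s∉orbit k ≤-refl (∙-cancelˡ x s _ (begin
        x ∙ s                 ≡⟨ xs≡t ⟩
        ε ∙ t                 ≡⟨ cong (_∙ t) (sym (proj₁ (proj₂ x-order))) ⟩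
        (x ∙ powℕ x k) ∙ t    ≡⟨ assoc _ _ _ ⟩
        x ∙ (powℕ x k ∙ t)    ∎))
      xs∉orbit (suc j) j<o xs≡xʲ⁺¹t =
        s∉orbit j (<-trans (n<1+n j) j<o) (∙-cancelˡ x s _ (trans xs≡xʲ⁺¹t (assoc _ _ _)))

    order∣size : ∀ T → LeftClosed x T → suc k ∣ ∣ T ∣
    order∣size T = go T (<-wellFounded ∣ T ∣)
      where
      go : ∀ T → Acc _<_ ∣ T ∣ → LeftClosed x T → suc k ∣ ∣ T ∣
      go T (acc smaller) closed with nonempty? T
      ... | no ∄t rewrite Empty-unique ∄t | ∣⊥∣≡0 N = suc k ∣0
      ... | yes (t , t∈T) = subst (suc k ∣_) (sym ∣T∣≡o+∣T′∣)
                              (∣m∣n⇒∣m+n ∣-refl (go _ (smaller ∣T′∣<∣T∣) (delete-closed closed)))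
        where
        ∣T∣≡o+∣T′∣ : ∣ T ∣ ≡ suc k + ∣ delete T t (suc k) ∣
        ∣T∣≡o+∣T′∣ = ∣delete∣ closed t∈T (suc k) ≤-refl
        ∣T′∣<∣T∣ : ∣ delete T t (suc k) ∣ < ∣ T ∣
        ∣T′∣<∣T∣ = subst (∣ delete T t (suc k) ∣ <_) (sym ∣T∣≡o+∣T′∣) (m<n+m ∣ delete T t (suc k) ∣ z<s)

  powℕ-∣S∣ : ∀ {S x} → IsSubgroup S → x ∈ S → powℕ x ∣ S ∣ ≡ ε
  powℕ-∣S∣ {S} {x} (_ , ∙-closed , _) x∈S with order x
  ... | suc k , x-order =
    powℕ-∣ {x} (Orbits.order∣size x-order S (λ s → ∙-closed x s x∈S)) (proj₁ (proj₂ x-order))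

  powℕ-N : ∀ x → powℕ x N ≡ ε
  powℕ-N x = subst (λ n → powℕ x n ≡ ε) (∣⊤∣≡n N) (powℕ-∣S∣ (∈⊤ , (λ _ _ _ _ → ∈⊤) , λ _ _ → ∈⊤) ∈⊤)

  -- Cyclic subgroups and elements of prime order

  infix 4 _∈⟨_⟩
  _∈⟨_⟩ : E → E → Set
  y ∈⟨ x ⟩ = ∃[ k ] y ≡ powℕ x k

  ∈⟨⟩-refl : ∀ {x} → x ∈⟨ x ⟩
  ∈⟨⟩-refl {x} = 1 , sym (identityʳ x)

  ∈⟨⟩-trans : ∀ {x y z} → y ∈⟨ x ⟩ → z ∈⟨ y ⟩ → z ∈⟨ x ⟩
  ∈⟨⟩-trans {x} (m , refl) (n , refl) = n * m , sym (powℕ-* x n m)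

  ⁻¹∈⟨⟩ : ∀ x → x ⁻¹ ∈⟨ x ⟩
  ⁻¹∈⟨⟩ x with order x
  ... | suc k , _ , xᵒ≡ε , _ = k , sym (inverseʳ-unique x (powℕ x k) xᵒ≡ε)

  InCyclic⇒∈⟨⟩ : ∀ {x y} → InCyclic x y → y ∈⟨ x ⟩
  InCyclic⇒∈⟨⟩ (+ k , y≡xᵏ) = k , y≡xᵏ
  InCyclic⇒∈⟨⟩ {x} (-[1+ k ] , refl) = ∈⟨⟩-trans (suc k , refl) (⁻¹∈⟨⟩ (powℕ x (suc k)))

  ∈⟨⟩⇒InCyclic : ∀ {x y} → y ∈⟨ x ⟩ → InCyclic x y
  ∈⟨⟩⇒InCyclic (k , y≡xᵏ) = + k , y≡xᵏ

  powℕ≡ε-∈⟨⟩ : ∀ {x y e} → y ∈⟨ x ⟩ → powℕ x e ≡ ε → powℕ y e ≡ ε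
  powℕ≡ε-∈⟨⟩ {x} {e = e} (k , refl) xᵉ≡ε = trans (sym (powℕ-* x e k)) (powℕ-∣ {x} {e} (m∣m*n k) xᵉ≡ε)

  coprime-factor∈⟨⟩ : ∀ {a b c d} → a ∙ b ≡ b ∙ a → Coprime c d
    → powℕ a c ≡ ε → powℕ b d ≡ ε → a ∈⟨ a ∙ b ⟩
  coprime-factor∈⟨⟩ {a} {b} {c} {d} ab≡ba c⊥d aᶜ≡ε bᵈ≡ε with Coprime.coprime-Bézout c⊥d
  ... | Bézout.-+ i j 1+i*c≡j*d = j * d , (begin
    a                      ≡⟨ sym (identityʳ a) ⟩
    a ∙ ε                  ≡⟨ cong (a ∙_) (sym (powℕ-∣ {a} (divides i refl) aᶜ≡ε)) ⟩
    powℕ a (1 + i * c)     ≡⟨ cong (powℕ a) 1+i*c≡j*d ⟩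
    powℕ a (j * d)         ≡⟨ sym (powℕ-∙-ε {t = j * d} ab≡ba (powℕ-∣ {b} (divides j refl) bᵈ≡ε)) ⟩
    powℕ (a ∙ b) (j * d)   ∎)
  ... | Bézout.+- i j 1+j*d≡i*c =
    subst (_∈⟨ a ∙ b ⟩) (⁻¹-involutive a) (∈⟨⟩-trans (j * d , a⁻¹≡[ab]ʲᵈ) (⁻¹∈⟨⟩ (a ⁻¹)))
    where
    a⁻¹≡[ab]ʲᵈ : a ⁻¹ ≡ powℕ (a ∙ b) (j * d)
    a⁻¹≡[ab]ʲᵈ = begin
      a ⁻¹                   ≡⟨ sym (inverseʳ-unique a _ (trans (cong (powℕ a) 1+j*d≡i*c)
                                                        (powℕ-∣ {a} (divides i refl) aᶜ≡ε))) ⟩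
      powℕ a (j * d)         ≡⟨ sym (powℕ-∙-ε {t = j * d} ab≡ba (powℕ-∣ {b} (divides j refl) bᵈ≡ε)) ⟩
      powℕ (a ∙ b) (j * d)   ∎

  prime-order⇒∣ : ∀ {x r t} → Prime r → x ≢ ε → powℕ x r ≡ ε → powℕ x t ≡ ε → r ∣ t
  prime-order⇒∣ {r = r} {t} r-prime x≢ε xʳ≡ε xᵗ≡ε with r ∣? t
  ... | yes r∣t = r∣t
  ... | no  r∤t = contradiction (coprime-exponents⇒ε (prime∤⇒coprime r-prime r∤t) xʳ≡ε xᵗ≡ε) x≢ε

  -- The common power is w ^ lcm i j: were it ε, r would divide both cofactors of lcm i j.
  prime-order-powers-meet : ∀ {r w y z} → Prime r → y ∈⟨ w ⟩ → z ∈⟨ w ⟩ → y ≢ ε → z ≢ ε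
    → powℕ y r ≡ ε → powℕ z r ≡ ε → ∃[ g ] g ≢ ε × g ∈⟨ y ⟩ × g ∈⟨ z ⟩
  prime-order-powers-meet {r} {w} r-prime (i , refl) (j , refl) y≢ε z≢ε yʳ≡ε zʳ≡ε =
    powℕ w (lcm i j) , wᴸ≢ε , (s , wᴸ≡yˢ) , (t , wᴸ≡zᵗ)
    where
    open _∣_ (m∣lcm[m,n] i j) renaming (quotient to s; equality to L≡s*i)
    open _∣_ (n∣lcm[m,n] i j) renaming (quotient to t; equality to L≡t*j)
    wᴸ≡yˢ : powℕ w (lcm i j) ≡ powℕ (powℕ w i) s
    wᴸ≡yˢ = trans (cong (powℕ w) L≡s*i) (powℕ-* w s i)
    wᴸ≡zᵗ : powℕ w (lcm i j) ≡ powℕ (powℕ w j) t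
    wᴸ≡zᵗ = trans (cong (powℕ w) L≡t*j) (powℕ-* w t j)
    L≢0 : lcm i j ≢ 0
    L≢0 = lcm≢0 i j {{≢-nonZero λ { refl → y≢ε refl }}} {{≢-nonZero λ { refl → z≢ε refl }}}
    wᴸ≢ε : powℕ w (lcm i j) ≢ ε
    wᴸ≢ε wᴸ≡ε = prime⇒≢1 r-prime (lcm-cofactors-coprime {i} {j} {s} {t} L≢0 L≡s*i L≡t*j
      ( prime-order⇒∣ {powℕ w i} r-prime y≢ε yʳ≡ε (trans (sym wᴸ≡yˢ) wᴸ≡ε)
      , prime-order⇒∣ {powℕ w j} r-prime z≢ε zʳ≡ε (trans (sym wᴸ≡zᵗ) wᴸ≡ε)))

  -- For prime r, this is r ∣ o(x): ⟨x⟩ contains an element of order r.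
  _∣ord_ : ℕ → E → Set
  r ∣ord x = ∃[ k ] powℕ x k ≢ ε × powℕ (powℕ x k) r ≡ ε

  ∣ord-∈⟨⟩ : ∀ {r x y} → y ∈⟨ x ⟩ → r ∣ord y → r ∣ord x
  ∣ord-∈⟨⟩ {r} {x} (m , refl) (k , yᵏ≢ε , yᵏʳ≡ε) =
    k * m , subst (λ g → g ≢ ε × powℕ g r ≡ ε) (sym (powℕ-* x k m)) (yᵏ≢ε , yᵏʳ≡ε)

  ∣ord-of-prime-power : ∀ {r x} a → x ≢ ε → powℕ x (r ^ a) ≡ ε → r ∣ord x
  ∣ord-of-prime-power {x = x} zero x≢ε x¹≡ε = contradiction (trans (sym (identityʳ x)) x¹≡ε) x≢ε
  ∣ord-of-prime-power {r} {x} (suc a) x≢ε xʳᵃ⁺¹≡ε with powℕ x (r ^ a) ≟ᶠ ε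
  ... | yes xʳᵃ≡ε = ∣ord-of-prime-power a x≢ε xʳᵃ≡ε
  ... | no  xʳᵃ≢ε = r ^ a , xʳᵃ≢ε , trans (sym (powℕ-* x r (r ^ a))) xʳᵃ⁺¹≡ε

  ∣ord-of-exponent : ∀ {p q x} m n → x ≢ ε → powℕ x (p ^ m * q ^ n) ≡ ε → p ∣ord x ⊎ q ∣ord x
  ∣ord-of-exponent {p} {q} {x} m n x≢ε xᵖᵐqⁿ≡ε with powℕ x (q ^ n) ≟ᶠ ε
  ... | yes xqⁿ≡ε = inj₂ (∣ord-of-prime-power n x≢ε xqⁿ≡ε)
  ... | no  xqⁿ≢ε = inj₁ (∣ord-∈⟨⟩ {p} {x} (q ^ n , refl)
                      (∣ord-of-prime-power {p} m xqⁿ≢ε (trans (sym (powℕ-* x (p ^ m) (q ^ n))) xᵖᵐqⁿ≡ε)))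

  ∣order⇒∣ord : ∀ {r x o} → Prime r → OrderIs x o → r ∣ o → r ∣ord x
  ∣order⇒∣ord {r} {x} r-prime (0<o , xᵒ≡ε , below-o) (divides c@(suc _) refl) =
    c , below-o c z<s (m<m*n c r (prime>1 r-prime)) ,
    trans (sym (powℕ-* x r c)) (trans (cong (powℕ x) (*-comm r c)) xᵒ≡ε)

  -- No avoiding path of length below 4

  Disjoint : E → E → Set
  Disjoint u v = ∀ g → g ∈⟨ u ⟩ → g ∈⟨ v ⟩ → g ≡ ε

  Disjoint⇒≢ : ∀ {u v} → Disjoint u v → u ≢ ε → u ≢ v
  Disjoint⇒≢ disjoint u≢ε refl = u≢ε (disjoint _ ∈⟨⟩-refl ∈⟨⟩-refl)

  SharesPrimesWith : E → E → Set
  SharesPrimesWith u v = ∀ x → x ∈⟨ u ⟩ → x ≢ ε → ∃[ r ] Prime r × r ∣ord x × r ∣ord v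

  no-common-root : ∀ {u v x w} → Disjoint u v → SharesPrimesWith u v
    → x ∈⟨ u ⟩ → x ≢ ε → x ∈⟨ w ⟩ → v ∈⟨ w ⟩ → ⊥
  no-common-root {u} {v} {x} {w} disjoint shares x∈⟨u⟩ x≢ε x∈⟨w⟩ v∈⟨w⟩
    with shares x x∈⟨u⟩ x≢ε
  ... | r , r-prime , (k , xᵏ≢ε , xᵏʳ≡ε) , (l , vˡ≢ε , vˡʳ≡ε)
    with prime-order-powers-meet r-prime (∈⟨⟩-trans x∈⟨w⟩ (k , refl)) (∈⟨⟩-trans v∈⟨w⟩ (l , refl))
           xᵏ≢ε vˡ≢ε xᵏʳ≡ε vˡʳ≡ε
  ... | g , g≢ε , g∈⟨xᵏ⟩ , g∈⟨vˡ⟩ =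
    g≢ε (disjoint g (∈⟨⟩-trans x∈⟨u⟩ (∈⟨⟩-trans (k , refl) g∈⟨xᵏ⟩)) (∈⟨⟩-trans (l , refl) g∈⟨vˡ⟩))

  Adjacent : E → E → Set
  Adjacent x y = y ∈⟨ x ⟩ ⊎ x ∈⟨ y ⟩

  PowAdj⇒Adjacent : ∀ {x y} → PowAdj x y → Adjacent x y
  PowAdj⇒Adjacent (_ , inj₁ y∈⟨x⟩) = inj₁ (InCyclic⇒∈⟨⟩ y∈⟨x⟩)
  PowAdj⇒Adjacent (_ , inj₂ x∈⟨y⟩) = inj₂ (InCyclic⇒∈⟨⟩ x∈⟨y⟩)

  module NoShortPath {u v} (u≢ε : u ≢ ε) (v≢ε : v ≢ ε) (disjoint : Disjoint u v)
                     (u-shares : SharesPrimesWith u v) (v-shares : SharesPrimesWith v u) where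

    disjoint′ : Disjoint v u
    disjoint′ g g∈⟨v⟩ g∈⟨u⟩ = disjoint g g∈⟨u⟩ g∈⟨v⟩

    no-walk₃ : ∀ {w₁ w₂} → w₁ ≢ ε → w₂ ≢ ε → Adjacent u w₁ → Adjacent w₁ w₂ → Adjacent w₂ v → ⊥
    no-walk₃ w₁≢ε w₂≢ε (inj₁ w₁∈⟨u⟩) (inj₁ w₂∈⟨w₁⟩) (inj₁ v∈⟨w₂⟩) =
      v≢ε (disjoint _ (∈⟨⟩-trans w₁∈⟨u⟩ (∈⟨⟩-trans w₂∈⟨w₁⟩ v∈⟨w₂⟩)) ∈⟨⟩-refl)
    no-walk₃ w₁≢ε w₂≢ε (inj₁ w₁∈⟨u⟩) (inj₁ w₂∈⟨w₁⟩) (inj₂ w₂∈⟨v⟩) =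
      w₂≢ε (disjoint _ (∈⟨⟩-trans w₁∈⟨u⟩ w₂∈⟨w₁⟩) w₂∈⟨v⟩)
    no-walk₃ w₁≢ε w₂≢ε (inj₁ w₁∈⟨u⟩) (inj₂ w₁∈⟨w₂⟩) (inj₁ v∈⟨w₂⟩) =
      no-common-root disjoint u-shares w₁∈⟨u⟩ w₁≢ε w₁∈⟨w₂⟩ v∈⟨w₂⟩
    no-walk₃ w₁≢ε w₂≢ε (inj₁ w₁∈⟨u⟩) (inj₂ w₁∈⟨w₂⟩) (inj₂ w₂∈⟨v⟩) =
      w₁≢ε (disjoint _ w₁∈⟨u⟩ (∈⟨⟩-trans w₂∈⟨v⟩ w₁∈⟨w₂⟩))
    no-walk₃ w₁≢ε w₂≢ε (inj₂ u∈⟨w₁⟩) (inj₁ w₂∈⟨w₁⟩) (inj₁ v∈⟨w₂⟩) =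
      no-common-root disjoint u-shares ∈⟨⟩-refl u≢ε u∈⟨w₁⟩ (∈⟨⟩-trans w₂∈⟨w₁⟩ v∈⟨w₂⟩)
    no-walk₃ w₁≢ε w₂≢ε (inj₂ u∈⟨w₁⟩) (inj₁ w₂∈⟨w₁⟩) (inj₂ w₂∈⟨v⟩) =
      no-common-root disjoint′ v-shares w₂∈⟨v⟩ w₂≢ε w₂∈⟨w₁⟩ u∈⟨w₁⟩
    no-walk₃ w₁≢ε w₂≢ε (inj₂ u∈⟨w₁⟩) (inj₂ w₁∈⟨w₂⟩) (inj₁ v∈⟨w₂⟩) =
      no-common-root disjoint u-shares ∈⟨⟩-refl u≢ε (∈⟨⟩-trans w₁∈⟨w₂⟩ u∈⟨w₁⟩) v∈⟨w₂⟩
    no-walk₃ w₁≢ε w₂≢ε (inj₂ u∈⟨w₁⟩) (inj₂ w₁∈⟨w₂⟩) (inj₂ w₂∈⟨v⟩) =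
      u≢ε (disjoint _ ∈⟨⟩-refl (∈⟨⟩-trans w₂∈⟨v⟩ (∈⟨⟩-trans w₁∈⟨w₂⟩ u∈⟨w₁⟩)))

    -- Shorter paths are walks of length 3 after repeating vertices, as Adjacent is reflexive.
    no-short-path : ∀ k → k < 4 → ¬ AvoidingPath u v k
    no-short-path 0 _ (w , w₀≡u , w₀≡v , _) = Disjoint⇒≢ disjoint u≢ε (trans (sym w₀≡u) w₀≡v)
    no-short-path 1 _ (w , w₀≡u , w₁≡v , edge , _) =
      no-walk₃ u≢ε v≢ε (inj₁ ∈⟨⟩-refl) (subst₂ Adjacent w₀≡u w₁≡v (PowAdj⇒Adjacent (edge fzero))) (inj₁ ∈⟨⟩-refl)
    no-short-path 2 _ (w , w₀≡u , w₂≡v , edge , w≢ε , _) =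
      no-walk₃ (w≢ε _) (w≢ε _)
        (subst (λ x → Adjacent x _) w₀≡u (PowAdj⇒Adjacent (edge fzero)))
        (inj₁ ∈⟨⟩-refl)
        (subst (Adjacent _) w₂≡v (PowAdj⇒Adjacent (edge (fsuc fzero))))
    no-short-path 3 _ (w , w₀≡u , w₃≡v , edge , w≢ε , _) =
      no-walk₃ (w≢ε _) (w≢ε _)
        (subst (λ x → Adjacent x _) w₀≡u (PowAdj⇒Adjacent (edge fzero)))
        (PowAdj⇒Adjacent (edge (fsuc fzero)))
        (subst (Adjacent _) w₃≡v (PowAdj⇒Adjacent (edge (fsuc (fsuc fzero)))))
    no-short-path (suc (suc (suc (suc _)))) (s≤s (s≤s (s≤s (s≤s ()))))

  -- As in the statement of the theorem, each ∃ extends to the end of its disjunct.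
  OrderCondition : ℕ → ℕ → E → E → Set
  OrderCondition p q u v =
      (∃[ a ] (1 ≤ a × OrderIs u (p ^ a)) × ∃[ b ] (1 ≤ b × OrderIs v (p ^ b)))
    ⊎ (∃[ a ] (1 ≤ a × OrderIs u (q ^ a)) × ∃[ b ] (1 ≤ b × OrderIs v (q ^ b)))
    ⊎ (∃[ k ] (OrderIs u k × (p ∣ k) × (q ∣ k)) × ∃[ l ] (OrderIs v l × (p ∣ l) × (q ∣ l)))

  OrderCondition-sym : ∀ {p q u v} → OrderCondition p q u v → OrderCondition p q v u
  OrderCondition-sym (inj₁ (a , u-order , b , v-order))        = inj₁ (b , v-order , a , u-order)
  OrderCondition-sym (inj₂ (inj₁ (a , u-order , b , v-order))) = inj₂ (inj₁ (b , v-order , a , u-order))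
  OrderCondition-sym (inj₂ (inj₂ (k , u-order , l , v-order))) = inj₂ (inj₂ (l , v-order , k , u-order))

  prime-power-orders-share : ∀ {u v r} a b → Prime r → v ≢ ε
    → powℕ u (r ^ a) ≡ ε → powℕ v (r ^ b) ≡ ε → SharesPrimesWith u v
  prime-power-orders-share {r = r} a b r-prime v≢ε uʳᵃ≡ε vʳᵇ≡ε x x∈⟨u⟩ x≢ε =
    r , r-prime , ∣ord-of-prime-power {r} a x≢ε (powℕ≡ε-∈⟨⟩ {e = r ^ a} x∈⟨u⟩ uʳᵃ≡ε) , ∣ord-of-prime-power {r} b v≢ε vʳᵇ≡ε

  two-prime-order-shares : ∀ {u v p q m n l} → Prime p → Prime q → N ≡ p ^ m * q ^ n
    → OrderIs v l → p ∣ l → q ∣ l → SharesPrimesWith u v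
  two-prime-order-shares {p = p} {q} {m} {n} p-prime q-prime N≡pᵐqⁿ v-order p∣l q∣l x _ x≢ε
    with ∣ord-of-exponent m n x≢ε (subst (λ e → powℕ x e ≡ ε) N≡pᵐqⁿ (powℕ-N x))
  ... | inj₁ p∣ord-x = p , p-prime , p∣ord-x , ∣order⇒∣ord p-prime v-order p∣l
  ... | inj₂ q∣ord-x = q , q-prime , q∣ord-x , ∣order⇒∣ord q-prime v-order q∣l

  OrderCondition⇒shares : ∀ {p q} m n {u v} → Prime p → Prime q → N ≡ p ^ m * q ^ n → v ≢ ε
    → OrderCondition p q u v → SharesPrimesWith u v
  OrderCondition⇒shares _ _ p-prime _ _ v≢ε (inj₁ (a , (_ , _ , uᵖᵃ≡ε , _) , b , (_ , _ , vᵖᵇ≡ε , _))) =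
    prime-power-orders-share a b p-prime v≢ε uᵖᵃ≡ε vᵖᵇ≡ε
  OrderCondition⇒shares _ _ _ q-prime _ v≢ε (inj₂ (inj₁ (a , (_ , _ , uqᵃ≡ε , _) , b , (_ , _ , vqᵇ≡ε , _)))) =
    prime-power-orders-share a b q-prime v≢ε uqᵃ≡ε vqᵇ≡ε
  OrderCondition⇒shares m n p-prime q-prime N≡pᵐqⁿ _ (inj₂ (inj₂ (_ , _ , l , (v-order , p∣l , q∣l)))) =
    two-prime-order-shares {m = m} {n} p-prime q-prime N≡pᵐqⁿ v-order p∣l q∣l

  -- An avoiding path of length 4

  Adjacent⇒PowAdj : ∀ {x y} → x ≢ y → Adjacent x y → PowAdj x y
  Adjacent⇒PowAdj x≢y x~y = x≢y , Sum.map ∈⟨⟩⇒InCyclic ∈⟨⟩⇒InCyclic x~y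

  avoidingPath₄ : ∀ {x₀ x₁ x₂ x₃ x₄} → Adjacent x₀ x₁ → Adjacent x₁ x₂ → Adjacent x₂ x₃ → Adjacent x₃ x₄
    → All (_≢ ε) (x₀ ∷ x₁ ∷ x₂ ∷ x₃ ∷ x₄ ∷ []) → Unique (x₀ ∷ x₁ ∷ x₂ ∷ x₃ ∷ x₄ ∷ [])
    → AvoidingPath x₀ x₄ 4
  avoidingPath₄ {x₀} {x₁} {x₂} {x₃} {x₄} x₀~x₁ x₁~x₂ x₂~x₃ x₃~x₄ nontrivial
    distinct@((x₀≢x₁ ∷ _) ∷ (x₁≢x₂ ∷ _) ∷ (x₂≢x₃ ∷ _) ∷ (x₃≢x₄ ∷ _) ∷ _) =
    lookup xs , refl , refl , edge , lookup⁺ nontrivial , lookup-injective distinct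
    where
    xs : Vec E 5
    xs = x₀ ∷ x₁ ∷ x₂ ∷ x₃ ∷ x₄ ∷ []
    edge : ∀ i → PowAdj (lookup xs (inject₁ i)) (lookup xs (fsuc i))
    edge fzero                      = Adjacent⇒PowAdj x₀≢x₁ x₀~x₁
    edge (fsuc fzero)               = Adjacent⇒PowAdj x₁≢x₂ x₁~x₂
    edge (fsuc (fsuc fzero))        = Adjacent⇒PowAdj x₂≢x₃ x₂~x₃
    edge (fsuc (fsuc (fsuc fzero))) = Adjacent⇒PowAdj x₃≢x₄ x₃~x₄

  record CoprimeSplitting : Set where
    field
      P Q        : Subset N
      P-subgroup : IsSubgroup P
      Q-subgroup : IsSubgroup Q
      eP eQ      : ℕ
      powℕ-eP    : ∀ a → a ∈ P → powℕ a eP ≡ ε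
      powℕ-eQ    : ∀ b → b ∈ Q → powℕ b eQ ≡ ε
      eP⊥eQ      : Coprime eP eQ
      commute    : ∀ a b → a ∈ P → b ∈ Q → a ∙ b ≡ b ∙ a
      factorise  : ∀ g → ∃[ a ] ∃[ b ] a ∈ P × b ∈ Q × g ≡ a ∙ b
      P∩Q≡ε      : ∀ g → g ∈ P → g ∈ Q → g ≡ ε

  swap-PQ : CoprimeSplitting → CoprimeSplitting
  swap-PQ S = record
    { P = Q ; Q = P ; P-subgroup = Q-subgroup ; Q-subgroup = P-subgroup ; eP = eQ ; eQ = eP
    ; powℕ-eP = powℕ-eQ ; powℕ-eQ = powℕ-eP ; eP⊥eQ = Coprime.sym eP⊥eQ
    ; commute = λ b a b∈Q a∈P → sym (commute a b a∈P b∈Q)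
    ; factorise = λ g → let (a , b , a∈P , b∈Q , g≡ab) = factorise g in
                        b , a , b∈Q , a∈P , trans g≡ab (commute a b a∈P b∈Q)
    ; P∩Q≡ε = λ g g∈Q g∈P → P∩Q≡ε g g∈P g∈Q
    }
    where open CoprimeSplitting S

  module Split (S : CoprimeSplitting) where
    open CoprimeSplitting S

    InP×Q : E → E → Set
    InP×Q a b = a ∈ P × b ∈ Q

    ε∈P : ε ∈ P
    ε∈P = proj₁ P-subgroup

    ε∈Q : ε ∈ Q
    ε∈Q = proj₁ Q-subgroup

    P-factor∈⟨⟩ : ∀ {a b} → InP×Q a b → a ∈⟨ a ∙ b ⟩
    P-factor∈⟨⟩ (a∈P , b∈Q) = coprime-factor∈⟨⟩ (commute _ _ a∈P b∈Q) eP⊥eQ (powℕ-eP _ a∈P) (powℕ-eQ _ b∈Q)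

    Q-factor∈⟨⟩ : ∀ {a b} → InP×Q a b → b ∈⟨ a ∙ b ⟩
    Q-factor∈⟨⟩ {a} {b} (a∈P , b∈Q) = subst (λ g → b ∈⟨ g ⟩) (sym (commute a b a∈P b∈Q))
      (coprime-factor∈⟨⟩ (sym (commute a b a∈P b∈Q)) (Coprime.sym eP⊥eQ) (powℕ-eQ _ b∈Q) (powℕ-eP _ a∈P))

    P-part∈⟨⟩ : ∀ {a b} → InP×Q a b → a ∙ ε ∈⟨ a ∙ b ⟩
    P-part∈⟨⟩ {a} {b} ab = subst (_∈⟨ a ∙ b ⟩) (sym (identityʳ a)) (P-factor∈⟨⟩ ab)

    Q-part∈⟨⟩ : ∀ {a b} → InP×Q a b → ε ∙ b ∈⟨ a ∙ b ⟩
    Q-part∈⟨⟩ {a} {b} ab = subst (_∈⟨ a ∙ b ⟩) (sym (identityˡ b)) (Q-factor∈⟨⟩ ab)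

    factors-unique : ∀ {a b a′ b′} → InP×Q a b → InP×Q a′ b′ → a ∙ b ≡ a′ ∙ b′ → a ≡ a′ × b ≡ b′
    factors-unique {a} {b} {a′} {b′} (a∈P , b∈Q) (a′∈P , b′∈Q) ab≡a′b′ = a≡a′ , b≡b′
      where
      c∙b≡b′ : (a′ ⁻¹ ∙ a) ∙ b ≡ b′
      c∙b≡b′ = begin
        (a′ ⁻¹ ∙ a) ∙ b     ≡⟨ assoc _ _ _ ⟩
        a′ ⁻¹ ∙ (a ∙ b)     ≡⟨ cong (a′ ⁻¹ ∙_) ab≡a′b′ ⟩
        a′ ⁻¹ ∙ (a′ ∙ b′)   ≡⟨ \\-leftDividesʳ a′ b′ ⟩
        b′                  ∎
      c≡ε : a′ ⁻¹ ∙ a ≡ ε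
      c≡ε = P∩Q≡ε _ (proj₁ (proj₂ P-subgroup) _ _ (proj₂ (proj₂ P-subgroup) a′ a′∈P) a∈P)
        (subst (_∈ Q) (sym (x≈z//y _ b b′ c∙b≡b′))
          (proj₁ (proj₂ Q-subgroup) _ _ b′∈Q (proj₂ (proj₂ Q-subgroup) b b∈Q)))
      a≡a′ : a ≡ a′
      a≡a′ = begin
        a                   ≡⟨ sym (\\-leftDividesˡ a′ a) ⟩
        a′ ∙ (a′ ⁻¹ ∙ a)    ≡⟨ cong (a′ ∙_) c≡ε ⟩
        a′ ∙ ε              ≡⟨ identityʳ a′ ⟩
        a′                  ∎
      b≡b′ : b ≡ b′
      b≡b′ = trans (sym (identityˡ b)) (trans (cong (_∙ b) (sym c≡ε)) c∙b≡b′)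

    ∙-≢ : ∀ {a b a′ b′} → InP×Q a b → InP×Q a′ b′ → a ≢ a′ ⊎ b ≢ b′ → a ∙ b ≢ a′ ∙ b′
    ∙-≢ ab a′b′ (inj₁ a≢a′) = a≢a′ ∘ proj₁ ∘ factors-unique ab a′b′
    ∙-≢ ab a′b′ (inj₂ b≢b′) = b≢b′ ∘ proj₂ ∘ factors-unique ab a′b′

    ∙-≢ε : ∀ {a b} → InP×Q a b → a ≢ ε ⊎ b ≢ ε → a ∙ b ≢ ε
    ∙-≢ε ab a≢ε⊎b≢ε ab≡ε = ∙-≢ ab (ε∈P , ε∈Q) a≢ε⊎b≢ε (trans ab≡ε (sym (identityˡ ε)))

    ∈P-by-exponent : ∀ {g e} → Coprime e eQ → powℕ g e ≡ ε → g ∈ P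
    ∈P-by-exponent {g} {e} e⊥eQ gᵉ≡ε with factorise g
    ... | a , b , a∈P , b∈Q , refl = subst (_∈ P) (sym (trans (cong (a ∙_) b≡ε) (identityʳ a))) a∈P
      where
      bᵉ≡aᵉ⁻¹ : powℕ b e ≡ powℕ a e ⁻¹
      bᵉ≡aᵉ⁻¹ = inverseʳ-unique (powℕ a e) (powℕ b e) (trans (sym (powℕ-∙ (commute a b a∈P b∈Q) e)) gᵉ≡ε)
      b≡ε : b ≡ ε
      b≡ε = coprime-exponents⇒ε e⊥eQ
        (P∩Q≡ε _ (subst (_∈ P) (sym bᵉ≡aᵉ⁻¹) (proj₂ (proj₂ P-subgroup) _ (powℕ-closed P-subgroup a∈P e)))
                 (powℕ-closed Q-subgroup b∈Q e))
        (powℕ-eQ b b∈Q)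

    path-through-Q : ∀ {u v y} → u ∈ P → v ∈ P → y ∈ Q → u ≢ ε → v ≢ ε → y ≢ ε → u ≢ v
      → AvoidingPath u v 4
    path-through-Q {u} {v} {y} u∈P v∈P y∈Q u≢ε v≢ε y≢ε u≢v =
      subst₂ (λ s t → AvoidingPath s t 4) (identityʳ u) (identityʳ v) (avoidingPath₄
        (inj₂ (P-part∈⟨⟩ UY)) (inj₁ (Q-part∈⟨⟩ UY)) (inj₂ (Q-part∈⟨⟩ VY)) (inj₁ (P-part∈⟨⟩ VY))
        (∙-≢ε U (inj₁ u≢ε) ∷ ∙-≢ε UY (inj₂ y≢ε) ∷ ∙-≢ε Y (inj₂ y≢ε) ∷ ∙-≢ε VY (inj₂ y≢ε) ∷ ∙-≢ε V (inj₁ v≢ε) ∷ [])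
        ( (∙-≢ U UY (inj₂ (y≢ε ∘ sym)) ∷ ∙-≢ U Y (inj₁ u≢ε) ∷ ∙-≢ U VY (inj₁ u≢v) ∷ ∙-≢ U V (inj₁ u≢v) ∷ [])
        ∷ (∙-≢ UY Y (inj₁ u≢ε) ∷ ∙-≢ UY VY (inj₁ u≢v) ∷ ∙-≢ UY V (inj₁ u≢v) ∷ [])
        ∷ (∙-≢ Y VY (inj₁ (v≢ε ∘ sym)) ∷ ∙-≢ Y V (inj₂ y≢ε) ∷ [])
        ∷ (∙-≢ VY V (inj₂ y≢ε) ∷ [])
        ∷ [] ∷ []))
      where
      U : InP×Q u ε
      U = u∈P , ε∈Q
      UY : InP×Q u y
      UY = u∈P , y∈Q
      Y : InP×Q ε y
      Y = ε∈P , y∈Q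
      VY : InP×Q v y
      VY = v∈P , y∈Q
      V : InP×Q v ε
      V = v∈P , ε∈Q

    path-through-factors : ∀ {a b a′ b′} → InP×Q a b → InP×Q a′ b′
      → a ≢ ε → b ≢ ε → a′ ≢ ε → b′ ≢ ε → a ≢ a′ → b ≢ b′ → AvoidingPath (a ∙ b) (a′ ∙ b′) 4
    path-through-factors {a} {b} {a′} {b′} AB A′B′ a≢ε b≢ε a′≢ε b′≢ε a≢a′ b≢b′ = avoidingPath₄
      (inj₁ (P-part∈⟨⟩ AB)) (inj₂ (P-part∈⟨⟩ AB′)) (inj₁ (Q-part∈⟨⟩ AB′)) (inj₂ (Q-part∈⟨⟩ A′B′))
      (∙-≢ε AB (inj₁ a≢ε) ∷ ∙-≢ε A (inj₁ a≢ε) ∷ ∙-≢ε AB′ (inj₁ a≢ε) ∷ ∙-≢ε B′ (inj₂ b′≢ε) ∷ ∙-≢ε A′B′ (inj₁ a′≢ε) ∷ [])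
      ( (∙-≢ AB A (inj₂ b≢ε) ∷ ∙-≢ AB AB′ (inj₂ b≢b′) ∷ ∙-≢ AB B′ (inj₁ a≢ε) ∷ ∙-≢ AB A′B′ (inj₁ a≢a′) ∷ [])
      ∷ (∙-≢ A AB′ (inj₂ (b′≢ε ∘ sym)) ∷ ∙-≢ A B′ (inj₁ a≢ε) ∷ ∙-≢ A A′B′ (inj₁ a≢a′) ∷ [])
      ∷ (∙-≢ AB′ B′ (inj₁ a≢ε) ∷ ∙-≢ AB′ A′B′ (inj₁ a≢a′) ∷ [])
      ∷ (∙-≢ B′ A′B′ (inj₁ (a′≢ε ∘ sym)) ∷ [])
      ∷ [] ∷ [])
      where
      A : InP×Q a ε
      A = proj₁ AB , ε∈Q
      AB′ : InP×Q a b′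
      AB′ = proj₁ AB , proj₂ A′B′
      B′ : InP×Q ε b′
      B′ = ε∈P , proj₂ A′B′

    path-within-P : ∀ {u v e e′} → 1 < ∣ Q ∣ → Coprime e eQ → Coprime e′ eQ → powℕ u e ≡ ε → powℕ v e′ ≡ ε
      → u ≢ ε → v ≢ ε → u ≢ v → AvoidingPath u v 4
    path-within-P 1<∣Q∣ e⊥eQ e′⊥eQ uᵉ≡ε vᵉ′≡ε u≢ε v≢ε u≢v with ∣p∣>1⇒∃y≢x ε∈Q 1<∣Q∣
    ... | y , y∈Q , y≢ε =
      path-through-Q (∈P-by-exponent e⊥eQ uᵉ≡ε) (∈P-by-exponent e′⊥eQ vᵉ′≡ε) y∈Q u≢ε v≢ε y≢ε u≢v

    P-factor≢ε : ∀ {a b} → InP×Q a b → powℕ (a ∙ b) eQ ≢ ε → a ≢ ε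
    P-factor≢ε (_ , b∈Q) [ab]ᵉᵠ≢ε refl = [ab]ᵉᵠ≢ε (trans (cong (λ g → powℕ g eQ) (identityˡ _)) (powℕ-eQ _ b∈Q))

    Q-factor≢ε : ∀ {a b} → InP×Q a b → powℕ (a ∙ b) eP ≢ ε → b ≢ ε
    Q-factor≢ε (a∈P , _) [ab]ᵉᴾ≢ε refl = [ab]ᵉᴾ≢ε (trans (cong (λ g → powℕ g eP) (identityʳ _)) (powℕ-eP _ a∈P))

    path-between-mixed : ∀ {u v} → Disjoint u v → powℕ u eP ≢ ε → powℕ u eQ ≢ ε → powℕ v eP ≢ ε → powℕ v eQ ≢ ε
      → AvoidingPath u v 4
    path-between-mixed {u} {v} disjoint uᵉᴾ≢ε uᵉᵠ≢ε vᵉᴾ≢ε vᵉᵠ≢ε with factorise u | factorise v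
    ... | a , b , a∈P , b∈Q , refl | a′ , b′ , a′∈P , b′∈Q , refl =
      path-through-factors AB A′B′ a≢ε (Q-factor≢ε AB uᵉᴾ≢ε) (P-factor≢ε A′B′ vᵉᵠ≢ε) (Q-factor≢ε A′B′ vᵉᴾ≢ε) a≢a′ b≢b′
      where
      AB : InP×Q a b
      AB = a∈P , b∈Q
      A′B′ : InP×Q a′ b′
      A′B′ = a′∈P , b′∈Q
      a≢ε : a ≢ ε
      a≢ε = P-factor≢ε AB uᵉᵠ≢ε
      a≢a′ : a ≢ a′
      a≢a′ refl = a≢ε (disjoint a (P-factor∈⟨⟩ AB) (P-factor∈⟨⟩ A′B′))
      b≢b′ : b ≢ b′
      b≢b′ refl = Q-factor≢ε AB uᵉᴾ≢ε (disjoint b (Q-factor∈⟨⟩ AB) (Q-factor∈⟨⟩ A′B′))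

  path-of-length-4 : ∀ {p q m n u v} → Prime p → Prime q → p ≢ q → 1 ≤ m → 1 ≤ n → NilpotentPQ p m q n
    → u ≢ ε → v ≢ ε → Disjoint u v → OrderCondition p q u v → AvoidingPath u v 4
  path-of-length-4 {p} {q} {m} {n} {u} {v} p-prime q-prime p≢q 1≤m 1≤n
    (P , Q , P-subgroup , Q-subgroup , ∣P∣≡pᵐ , ∣Q∣≡qⁿ , commute , factorise , P∩Q≡ε) u≢ε v≢ε disjoint = path
    where
    p⊥q : Coprime p q
    p⊥q = distinct-primes-coprime p-prime q-prime p≢q
    S : CoprimeSplitting
    S = record
      { P = P ; Q = Q ; P-subgroup = P-subgroup ; Q-subgroup = Q-subgroup ; eP = p ^ m ; eQ = q ^ n
      ; powℕ-eP = λ a a∈P → subst (λ e → powℕ a e ≡ ε) ∣P∣≡pᵐ (powℕ-∣S∣ P-subgroup a∈P)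
      ; powℕ-eQ = λ b b∈Q → subst (λ e → powℕ b e ≡ ε) ∣Q∣≡qⁿ (powℕ-∣S∣ Q-subgroup b∈Q)
      ; eP⊥eQ = coprime-^ m n p⊥q
      ; commute = commute ; factorise = factorise ; P∩Q≡ε = P∩Q≡ε
      }
    u≢v : u ≢ v
    u≢v = Disjoint⇒≢ disjoint u≢ε
    path : OrderCondition p q u v → AvoidingPath u v 4
    path (inj₁ (a , (_ , _ , uᵖᵃ≡ε , _) , b , (_ , _ , vᵖᵇ≡ε , _))) =
      Split.path-within-P S (subst (1 <_) (sym ∣Q∣≡qⁿ) (1<prime^ q-prime 1≤n))
        (coprime-^ a n p⊥q) (coprime-^ b n p⊥q) uᵖᵃ≡ε vᵖᵇ≡ε u≢ε v≢ε u≢v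
    path (inj₂ (inj₁ (a , (_ , _ , uqᵃ≡ε , _) , b , (_ , _ , vqᵇ≡ε , _)))) =
      Split.path-within-P (swap-PQ S) (subst (1 <_) (sym ∣P∣≡pᵐ) (1<prime^ p-prime 1≤m))
        (coprime-^ a m (Coprime.sym p⊥q)) (coprime-^ b m (Coprime.sym p⊥q)) uqᵃ≡ε vqᵇ≡ε u≢ε v≢ε u≢v
    path (inj₂ (inj₂ (k , (u-order , p∣k , q∣k) , l , (v-order , p∣l , q∣l)))) =
      Split.path-between-mixed S disjoint
        (powℕ≢ε-by-order u-order q∣k q∤pᵐ) (powℕ≢ε-by-order u-order p∣k p∤qⁿ)
        (powℕ≢ε-by-order v-order q∣l q∤pᵐ) (powℕ≢ε-by-order v-order p∣l p∤qⁿ)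
      where
      q∤pᵐ : q ∤ p ^ m
      q∤pᵐ = prime∤prime^ q-prime p-prime (p≢q ∘ sym) m
      p∤qⁿ : p ∤ q ^ n
      p∤qⁿ = prime∤prime^ p-prime q-prime p≢q n

mainTheorem12 : (N p q m n : ℕ) → Prime p → Prime q → p ≢ q → 1 ≤ m → 1 ≤ n
  → N ≡ p ^ m * q ^ n → (G : FinGroup N)
  → FinGroup.NilpotentPQ G p m q n → ¬ FinGroup.Cyclic G
  → (u v : Fin N) → u ≢ FinGroup.ε G → v ≢ FinGroup.ε G
  → (∀ x → FinGroup.InCyclic G u x → FinGroup.InCyclic G v x → x ≡ FinGroup.ε G)
  → ((∃[ a ] (1 ≤ a × FinGroup.OrderIs G u (p ^ a)) × ∃[ b ] (1 ≤ b × FinGroup.OrderIs G v (p ^ b)))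
    ⊎ (∃[ a ] (1 ≤ a × FinGroup.OrderIs G u (q ^ a)) × ∃[ b ] (1 ≤ b × FinGroup.OrderIs G v (q ^ b)))
    ⊎ (∃[ k ] (FinGroup.OrderIs G u k × p ∣ k × q ∣ k) × ∃[ l ] (FinGroup.OrderIs G v l × p ∣ l × q ∣ l)))
  → FinGroup.AvoidingPath G u v 4 × (∀ k → k < 4 → ¬ FinGroup.AvoidingPath G u v k)
mainTheorem12 N p q m n p-prime q-prime p≢q 1≤m 1≤n N≡pᵐqⁿ G nilpotent _ u v u≢ε v≢ε ⟨u⟩∩⟨v⟩≡1 condition =
  path-of-length-4 p-prime q-prime p≢q 1≤m 1≤n nilpotent u≢ε v≢ε disjoint condition ,
  NoShortPath.no-short-path u≢ε v≢ε disjoint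
    (OrderCondition⇒shares m n p-prime q-prime N≡pᵐqⁿ v≢ε condition)
    (OrderCondition⇒shares m n p-prime q-prime N≡pᵐqⁿ u≢ε (OrderCondition-sym condition))
  where
  open FinGroupTheory G
  disjoint : Disjoint u v
  disjoint g g∈⟨u⟩ g∈⟨v⟩ = ⟨u⟩∩⟨v⟩≡1 g (∈⟨⟩⇒InCyclic g∈⟨u⟩) (∈⟨⟩⇒InCyclic g∈⟨v⟩)
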